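{- Let $q\ge3$ be odd, let $\mathbf f\in A_q^+\setminus V$ have last symbol $0$, let $\ell\ge1$ be the length of the maximal suffix of $\mathbf f$ consisting only of $0$s, and let $\mathbf p\in A_q^*(\mathbf f)$. If $\mathbf a$ is the $\triangleleft$-first or the $\triangleleft$-last word of $\mathbf p|A_q^\infty(\mathbf f)$, then $\mathbf a=\mathbf p\mathbf r0^\infty$, where: (1) if $\mathbf a$ is the $\triangleleft$-first word and $\mathbf p$ has even parity, or $\mathbf a$ is the $\triangleleft$-last word and $\mathbf p$ has odd parity, then $\mathbf r=\epsilon$ or $\mathbf r=0^i1$ for some $0\le i\le\ell-1$; (2) if $\mathbf a$ is the $\triangleleft$-first word and $\mathbf p$ has odd parity, or $\mathbf a$ is the $\triangleleft$-last word and $\mathbf p$ has even parity, then $\mathbf r=(q-1)$ or $\mathbf r=(q-1)0^{\ell-1}1$.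
   Context: $A_q=\{0,1,\dots,q-1\}$. $A_q^*$ (resp. $A_q^+$) is the set of all (resp. nonempty) finite words, $\epsilon$ the empty word, $A_q^\infty$ the right-infinite words; $\mathbf a^i$ is $i$-fold concatenation, $\mathbf a^\infty=\mathbf a\mathbf a\cdots$, $\mathbf a^{ -\infty}=\cdots\mathbf a\mathbf a$ (left-infinite), and a suffix of a left-infinite word is a finite (possibly empty) word with which it ends. For a set $X$ of words, $X(\mathbf f)$ is the set of words of $X$ not containing $\mathbf f$ as a factor (contiguous subword), $\mathbf p|X$ the words of $X$ with prefix $\mathbf p$. For distinct words $\mathbf s,\mathbf t$ of the same (finite or infinite) length, with $k$ the leftmost differing position, $u=\sum_{i<k}s_i$ and $v$ the number of nonzero symbols among $s_1,\dots,s_{k-1}$, $\mathbf s\triangleleft\mathbf t$ iff ($u+v$ even and $s_k<t_k$) or ($u+v$ odd and $s_k>t_k$); $\triangleleft$-first/last mean least/greatest. For odd $q$, the parity of a word $a_1\cdots a_n$ is the parity of $\sum_i a_i+\#\{i:a_i\ne0\}$. $V=\bigcup_{m\ge0}\{\mathbf b0:\mathbf b\text{ a suffix of }(10^m)^{ -\infty}\}$. -}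

module Defs where

open import Data.Nat using (ℕ; zero; suc; _+_; _∸_; _<_; _>_; _%_)
open import Data.List using (List; []; _∷_; _++_; length; map; upTo; replicate; concat; reverse)
open import Data.List.Relation.Unary.All using (All)
open import Data.Product using (Σ; ∃; _×_; _,_)
open import Data.Sum using (_⊎_)
open import Relation.Binary.PropositionalEquality using (_≡_)
open import Relation.Nullary using (¬_)

Word : ℕ → List ℕ → Set
Word q w = All (_< q) w

InfWord : ℕ → (ℕ → ℕ) → Set
InfWord q a = ∀ n → a n < q

_≈_ : (ℕ → ℕ) → (ℕ → ℕ) → Set
a ≈ b = ∀ n → a n ≡ b n

window : (ℕ → ℕ) → ℕ → ℕ → List ℕ
window a n k = map (λ i → a (n + i)) (upTo k)

FactorOf : List ℕ → List ℕ → Set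
FactorOf f w = ∃ λ u → ∃ λ v → w ≡ u ++ f ++ v

InfFactorOf : List ℕ → (ℕ → ℕ) → Set
InfFactorOf f a = ∃ λ n → window a n (length f) ≡ f

PrefixOf : List ℕ → (ℕ → ℕ) → Set
PrefixOf p a = window a 0 (length p) ≡ p

pad0 : List ℕ → ℕ → ℕ
pad0 []       n       = 0
pad0 (x ∷ w)  zero    = x
pad0 (x ∷ w)  (suc n) = pad0 w n

symWeight : ℕ → ℕ
symWeight zero    = 0
symWeight (suc x) = suc (suc x)

-- sum of symbols + number of nonzero symbols
weight : List ℕ → ℕ
weight []      = 0
weight (x ∷ w) = symWeight x + weight w

EvenParity : List ℕ → Set
EvenParity w = weight w % 2 ≡ 0

OddParity : List ℕ → Set
OddParity w = weight w % 2 ≡ 1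

_◁_ : (ℕ → ℕ) → (ℕ → ℕ) → Set
s ◁ t = ∃ λ k → (∀ i → i < k → s i ≡ t i) ×
          ((EvenParity (window s 0 k) × s k < t k) ⊎
           (OddParity (window s 0 k) × s k > t k))

InSet : ℕ → List ℕ → List ℕ → (ℕ → ℕ) → Set
InSet q f p a = InfWord q a × ¬ InfFactorOf f a × PrefixOf p a

IsFirst : ℕ → List ℕ → List ℕ → (ℕ → ℕ) → Set
IsFirst q f p a = InSet q f p a × (∀ b → InSet q f p b → a ≈ b ⊎ a ◁ b)

IsLast : ℕ → List ℕ → List ℕ → (ℕ → ℕ) → Set
IsLast q f p a = InSet q f p a × (∀ b → InSet q f p b → b ≈ a ⊎ b ◁ a)

-- b is a suffix of the left-infinite word (1 0^m)^{-∞}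
SuffixOfPeriodic : ℕ → List ℕ → Set
SuffixOfPeriodic m b = ∃ λ k → ∃ λ c → c ++ b ≡ concat (replicate k (1 ∷ replicate m 0))

InV : List ℕ → Set
InV w = ∃ λ m → ∃ λ b → SuffixOfPeriodic m b × w ≡ b ++ (0 ∷ [])

leadingZeros : List ℕ → ℕ
leadingZeros []          = 0
leadingZeros (zero ∷ w)  = suc (leadingZeros w)
leadingZeros (suc _ ∷ w) = 0

trailingZeros : List ℕ → ℕ
trailingZeros w = leadingZeros (reverse w)

Shape1 : ℕ → List ℕ → Set
Shape1 ℓ r = r ≡ [] ⊎ (∃ λ i → i < ℓ × r ≡ replicate i 0 ++ (1 ∷ []))

Shape2 : ℕ → ℕ → List ℕ → Set
Shape2 q ℓ r = r ≡ (q ∸ 1) ∷ [] ⊎ r ≡ (q ∸ 1) ∷ replicate (ℓ ∸ 1) 0 ++ (1 ∷ [])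

module Submission where

-- Let ℓ be the number of trailing zeros of f and e = q - 1 the maximal symbol.  Both
-- halves are proved at once for the order ◁[σ], which is ◁ with every prefix parity
-- shifted by σ: ◁ is ◁[0] and the reverse of ◁ is ◁[1].
-- For a prefix P, a tail r is ε or 0^m 1 with P 0^(m+1) ending in f.  Past P the
-- candidate P r 0^∞ uses only the symbols 0 and 1, so its prefixes keep the parity of
-- P; if that shifted parity is even, an f-avoiding word could beat it only by a 0
-- under the single 1, which would complete f.  The combinatorial heart is that the
-- tail with least m avoids f: an occurrence of f across the 1 would give f = g 1 0^ℓ
-- with g a suffix of (1 0^(ℓ-1))^{-∞}, i.e. f ∈ V.  If p has even shifted parity we
-- use P = p; otherwise P = p e, of even shifted parity as q is odd, and nothing beats
-- the maximal symbol e; the least tail of p e is then ε or 0^(ℓ-1) 1.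
-- Order of the file: prefixes, suffixes, factors and reversal; windows of infinite
-- words; the shape of f and the periodicity argument; avoidance by the least tail;
-- parities; the order ◁[σ] and minimality of candidates; proposition8.

open import Defs
open import Data.Nat using (ℕ; zero; suc; _+_; _∸_; _≤_; _<_; _>_; _%_; z≤n; s≤s)
open import Data.Nat.Properties
open import Data.Nat.DivMod using (%-distribˡ-+; m%n<n; m<n⇒m%n≡m)
open import Data.List using (List; []; _∷_; _++_; length; map; applyUpTo; replicate; concat; reverse)
open import Data.List.Properties using (++-assoc; ++-identityʳ; reverse-++; unfold-reverse; reverse-involutive; length-++; ∷-injective; ∷-injectiveˡ; ∷-injectiveʳ; length-++-≤ʳ)
open import Data.List.Relation.Unary.All as All using (All)
open import Data.List.Relation.Unary.All.Properties using (++⁺)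
open import Data.Product using (∃; _×_; _,_; proj₁; map₁)
open import Data.Sum using (_⊎_; inj₁; inj₂; [_,_]′)
open import Data.Empty using (⊥-elim)
open import Function using (id)
open import Relation.Binary.PropositionalEquality
open import Relation.Binary.Definitions using (tri<; tri≈; tri>)
open import Relation.Nullary using (¬_; Dec; yes; no)
open import Relation.Nullary.Decidable using (map′)

Prefix : List ℕ → List ℕ → Set
Prefix u x = ∃ λ B → x ≡ u ++ B

Suffix : List ℕ → List ℕ → Set
Suffix u x = ∃ λ A → x ≡ A ++ u

prefix? : ∀ u x → Dec (Prefix u x)
prefix? []      x       = yes (x , refl)
prefix? (a ∷ u) []      = no λ { (_ , ()) }
prefix? (a ∷ u) (b ∷ x) with a ≟ b | prefix? u x
... | yes refl | yes (B , e) = yes (B , cong (a ∷_) e)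
... | yes refl | no ¬pre     = no λ { (B , e) → ¬pre (B , ∷-injectiveʳ e) }
... | no a≢b   | _           = no λ { (B , e) → a≢b (sym (∷-injectiveˡ e)) }

prefix⇒factor : ∀ {u x} → Prefix u x → FactorOf u x
prefix⇒factor (B , e) = [] , B , e

prefix-∷⁻ : ∀ {x y u v} → Prefix (x ∷ u) (y ∷ v) → Prefix u v
prefix-∷⁻ (B , e) = B , ∷-injectiveʳ e

prefix-of-prefixes : ∀ u v S → Prefix u S → Prefix v S → length u ≤ length v → Prefix u v
prefix-of-prefixes []      v       S       _        _        _        = v , refl
prefix-of-prefixes (x ∷ u) (y ∷ v) []      (_ , ()) _        _
prefix-of-prefixes (x ∷ u) (y ∷ v) (s ∷ S) (B , eu) (C , ev) (s≤s le)
  with ∷-injective eu | ∷-injective ev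
... | refl , eu' | refl , ev' with prefix-of-prefixes u v S (B , eu') (C , ev') le
...   | D , e = D , cong (x ∷_) e

prefix-split : ∀ H Q X → Prefix H (Q ++ X) → Prefix H Q ⊎ (∃ λ H' → H ≡ Q ++ H' × Prefix H' X)
prefix-split H       []      X p       = inj₂ (H , refl , p)
prefix-split []      (x ∷ Q) X p       = inj₁ (x ∷ Q , refl)
prefix-split (h ∷ H) (x ∷ Q) X (B , e) with ∷-injective e
... | refl , e' with prefix-split H Q X (B , e')
...   | inj₁ (C , e'')          = inj₁ (C , cong (x ∷_) e'')
...   | inj₂ (H' , refl , pre) = inj₂ (H' , refl , pre)

prefix-of-power : ∀ Q H → 0 < length Q → Prefix H (Q ++ H) → ∃ λ k → Prefix H (concat (replicate k Q))
prefix-of-power Q H 0<|Q| = go (suc (length H)) H ≤-refl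
  where
    shorter : ∀ {fuel} H' → length (Q ++ H') < suc fuel → length H' < fuel
    shorter H' lt = ≤-trans (+-monoˡ-≤ (length H') 0<|Q|) (subst (_≤ _) (length-++ Q) (≤-pred lt))

    go : ∀ fuel X → length X < fuel → Prefix X (Q ++ X) → ∃ λ k → Prefix X (concat (replicate k Q))
    go (suc fuel) X lt pre with prefix-split X Q X pre
    ... | inj₁ (C , e) = 1 , C , trans (++-identityʳ Q) e
    ... | inj₂ (X' , refl , pre') with go fuel X' (shorter X' lt) pre'
    ...   | k , C , e = suc k , C , trans (cong (Q ++_) e) (sym (++-assoc Q X' C))

replicate-snoc : ∀ n (x : ℕ) → replicate (suc n) x ≡ replicate n x ++ x ∷ []
replicate-snoc zero    x = refl
replicate-snoc (suc n) x = cong (x ∷_) (replicate-snoc n x)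

reverse-replicate : ∀ n (x : ℕ) → reverse (replicate n x) ≡ replicate n x
reverse-replicate zero    x = refl
reverse-replicate (suc n) x =
  trans (unfold-reverse x (replicate n x)) (trans (cong (_++ x ∷ []) (reverse-replicate n x)) (sym (replicate-snoc n x)))

reverse-padding : ∀ P t → reverse (P ++ replicate t 0) ≡ replicate t 0 ++ reverse P
reverse-padding P t = trans (reverse-++ P (replicate t 0)) (cong (_++ reverse P) (reverse-replicate t 0))

reverse-bump : ∀ m → reverse (replicate m 0 ++ 1 ∷ []) ≡ 1 ∷ replicate m 0
reverse-bump m = trans (reverse-++ (replicate m 0) (1 ∷ [])) (cong (1 ∷_) (reverse-replicate m 0))

power-comm : ∀ k (Q : List ℕ) → concat (replicate k Q) ++ Q ≡ Q ++ concat (replicate k Q)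
power-comm zero    Q = sym (++-identityʳ Q)
power-comm (suc k) Q = trans (++-assoc Q _ Q) (cong (Q ++_) (power-comm k Q))

reverse-power : ∀ k (Q : List ℕ) → reverse (concat (replicate k Q)) ≡ concat (replicate k (reverse Q))
reverse-power zero    Q = refl
reverse-power (suc k) Q =
  trans (reverse-++ Q (concat (replicate k Q)))
        (trans (cong (_++ reverse Q) (reverse-power k Q)) (power-comm k (reverse Q)))

factor-reverse : ∀ {u x} → FactorOf u x → FactorOf (reverse u) (reverse x)
factor-reverse {u} (A , B , refl) = reverse B , reverse A , (begin
  reverse (A ++ u ++ B)                  ≡⟨ reverse-++ A (u ++ B) ⟩
  reverse (u ++ B) ++ reverse A          ≡⟨ cong (_++ reverse A) (reverse-++ u B) ⟩
  (reverse B ++ reverse u) ++ reverse A  ≡⟨ ++-assoc (reverse B) _ _ ⟩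
  reverse B ++ reverse u ++ reverse A    ∎)
  where open ≡-Reasoning

factor-reverse⁻ : ∀ {u x} → FactorOf (reverse u) (reverse x) → FactorOf u x
factor-reverse⁻ {u} {x} o = subst₂ FactorOf (reverse-involutive u) (reverse-involutive x) (factor-reverse o)

suffix-reverse : ∀ {u x} → Suffix u x → Prefix (reverse u) (reverse x)
suffix-reverse {u} (A , refl) = reverse A , reverse-++ A u

prefix-reverse⁻ : ∀ {u x} → Prefix (reverse u) (reverse x) → Suffix u x
prefix-reverse⁻ {u} {x} (B , e) = reverse B , (begin
  x                                ≡⟨ sym (reverse-involutive x) ⟩
  reverse (reverse x)              ≡⟨ cong reverse e ⟩
  reverse (reverse u ++ B)         ≡⟨ reverse-++ (reverse u) B ⟩
  reverse B ++ reverse (reverse u) ≡⟨ cong (reverse B ++_) (reverse-involutive u) ⟩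
  reverse B ++ u                   ∎)
  where open ≡-Reasoning

suffix? : ∀ u x → Dec (Suffix u x)
suffix? u x = map′ prefix-reverse⁻ suffix-reverse (prefix? (reverse u) (reverse x))

factor-∷ : ∀ R x Y → FactorOf R (x ∷ Y) → Prefix R (x ∷ Y) ⊎ FactorOf R Y
factor-∷ R x Y ([]    , B , e) = inj₁ (B , e)
factor-∷ R x Y (_ ∷ A , B , e) = inj₂ (A , B , ∷-injectiveʳ e)

factor-zeros : ∀ R M Y → FactorOf R (replicate M 0 ++ Y) →
               (∃ λ u → u ≤ M × Prefix R (replicate u 0 ++ Y)) ⊎ FactorOf R Y
factor-zeros R zero    Y o = inj₂ o
factor-zeros R (suc M) Y o with factor-∷ R 0 (replicate M 0 ++ Y) o
... | inj₁ pre = inj₁ (suc M , ≤-refl , pre)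
... | inj₂ o' with factor-zeros R M Y o'
...   | inj₁ (u , u≤M , pre) = inj₁ (u , m≤n⇒m≤1+n u≤M , pre)
...   | inj₂ o''             = inj₂ o''

zeros-prefix : ∀ ℓ d G t Y → Prefix (replicate ℓ 0 ++ d ∷ G) (replicate t 0 ++ Y) → d ≢ 0 →
               t ≤ ℓ × Prefix (replicate (ℓ ∸ t) 0 ++ d ∷ G) Y
zeros-prefix ℓ       d G zero    Y pre     _   = z≤n , pre
zeros-prefix zero    d G (suc t) Y (B , e) d≢0 = ⊥-elim (d≢0 (sym (∷-injectiveˡ e)))
zeros-prefix (suc ℓ) d G (suc t) Y (B , e) d≢0 with zeros-prefix ℓ d G t Y (B , ∷-injectiveʳ e) d≢0
... | t≤ℓ , pre = s≤s t≤ℓ , pre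

nonzero-prefix : ∀ n d G c Y → Prefix (replicate n 0 ++ d ∷ G) (c ∷ Y) → c ≢ 0 → n ≡ 0 × c ≡ d × Prefix G Y
nonzero-prefix zero    d G c Y (B , e) _   = refl , ∷-injectiveˡ e , B , ∷-injectiveʳ e
nonzero-prefix (suc n) d G c Y (B , e) c≢0 = ⊥-elim (c≢0 (∷-injectiveˡ e))

block-prefix : ∀ ℓ d G t c Y → Prefix (replicate ℓ 0 ++ d ∷ G) (replicate t 0 ++ c ∷ Y) → d ≢ 0 → c ≢ 0 →
               t ≡ ℓ × c ≡ d × Prefix G Y
block-prefix ℓ d G t c Y pre d≢0 c≢0 with zeros-prefix ℓ d G t (c ∷ Y) pre d≢0
... | t≤ℓ , pre' with nonzero-prefix (ℓ ∸ t) d G c Y pre' c≢0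
...   | ℓ∸t≡0 , c≡d , preG = ≤-antisym t≤ℓ (m∸n≡0⇒m≤n ℓ∸t≡0) , c≡d , preG

win : (ℕ → ℕ) → ℕ → List ℕ
win a zero    = []
win a (suc k) = a 0 ∷ win (λ i → a (suc i)) k

map-applyUpTo : ∀ (g h : ℕ → ℕ) k → map g (applyUpTo h k) ≡ win (λ i → g (h i)) k
map-applyUpTo g h zero    = refl
map-applyUpTo g h (suc k) = cong (g (h 0) ∷_) (map-applyUpTo g (λ i → h (suc i)) k)

window≡win : ∀ a n k → window a n k ≡ win (λ i → a (n + i)) k
window≡win a n k = map-applyUpTo (λ i → a (n + i)) id k

win-cong : ∀ a b k → (∀ i → i < k → a i ≡ b i) → win a k ≡ win b k
win-cong a b zero    _  = refl
win-cong a b (suc k) eq =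
  cong₂ _∷_ (eq 0 (s≤s z≤n)) (win-cong (λ i → a (suc i)) (λ i → b (suc i)) k (λ i i<k → eq (suc i) (s≤s i<k)))

win-pointwise : ∀ a b k → win a k ≡ win b k → ∀ i → i < k → a i ≡ b i
win-pointwise a b (suc k) e zero    _         = ∷-injectiveˡ e
win-pointwise a b (suc k) e (suc i) (s≤s i<k) =
  win-pointwise (λ j → a (suc j)) (λ j → b (suc j)) k (∷-injectiveʳ e) i i<k

win-++ : ∀ a n k → win a (n + k) ≡ win a n ++ win (λ i → a (n + i)) k
win-++ a zero    k = refl
win-++ a (suc n) k = cong (a 0 ∷_) (win-++ (λ i → a (suc i)) n k)

length-win : ∀ a k → length (win a k) ≡ k
length-win a zero    = refl
length-win a (suc k) = cong suc (length-win (λ i → a (suc i)) k)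

window-agree : ∀ {s t} k → (∀ i → i < k → s i ≡ t i) → window s 0 k ≡ window t 0 k
window-agree {s} {t} k agree = trans (window≡win s 0 k) (trans (win-cong s t k agree) (sym (window≡win t 0 k)))

prefix-agree : ∀ {P b c k} → PrefixOf P b → PrefixOf P c → k < length P → b k ≡ c k
prefix-agree {P} {b} {c} pb pc =
  win-pointwise b c (length P)
    (trans (trans (sym (window≡win b 0 (length P))) pb) (sym (trans (sym (window≡win c 0 (length P))) pc))) _

++-cancel-≡-length : ∀ (A B X Y : List ℕ) → A ++ X ≡ B ++ Y → length A ≡ length B → X ≡ Y
++-cancel-≡-length []      []      X Y e _ = e
++-cancel-≡-length (a ∷ A) (b ∷ B) X Y e l = ++-cancel-≡-length A B X Y (∷-injectiveʳ e) (suc-injective l)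

window-suffix⇒factor : ∀ {f} b N A → win b N ≡ A ++ f → InfFactorOf f b
window-suffix⇒factor {f} b N A e =
  length A , trans (window≡win b (length A) (length f)) (++-cancel-≡-length _ A _ f split (length-win b (length A)))
  where
    N≡ : length A + length f ≡ N
    N≡ = trans (sym (length-++ A)) (trans (cong length (sym e)) (length-win b N))
    split : win b (length A) ++ win (λ i → b (length A + i)) (length f) ≡ A ++ f
    split = trans (sym (win-++ b (length A) (length f))) (subst (λ z → win b z ≡ A ++ f) (sym N≡) e)

pad0-++ : ∀ u v j → pad0 (u ++ v) (length u + j) ≡ pad0 v j
pad0-++ []      v j = refl
pad0-++ (x ∷ u) v j = pad0-++ u v j

pad0-after : ∀ u x v → pad0 (u ++ x ∷ v) (length u) ≡ x
pad0-after []      x v = refl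
pad0-after (y ∷ u) x v = pad0-after u x v

win-pad0-prefix : ∀ u v → win (pad0 (u ++ v)) (length u) ≡ u
win-pad0-prefix []      v = refl
win-pad0-prefix (x ∷ u) v = cong (x ∷_) (win-pad0-prefix u v)

win-pad0-++ : ∀ u v j → win (pad0 (u ++ v)) (length u + j) ≡ u ++ win (pad0 v) j
win-pad0-++ []      v j = refl
win-pad0-++ (x ∷ u) v j = cong (x ∷_) (win-pad0-++ u v j)

win-pad0-zeros : ∀ m xs → win (pad0 (replicate m 0 ++ xs)) m ≡ replicate m 0
win-pad0-zeros zero    xs = refl
win-pad0-zeros (suc m) xs = cong (0 ∷_) (win-pad0-zeros m xs)

candidate-prefix : ∀ p r → PrefixOf p (pad0 (p ++ r))
candidate-prefix p r = trans (window≡win (pad0 (p ++ r)) 0 (length p)) (win-pad0-prefix p r)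

pad0-word : ∀ {q} w → Word (suc q) w → InfWord (suc q) (pad0 w)
pad0-word []      _              n       = s≤s z≤n
pad0-word (x ∷ w) (x<q All.∷ _)  zero    = x<q
pad0-word (x ∷ w) (_ All.∷ w<q) (suc n) = pad0-word w w<q n

padded-prefix : ∀ w N → Prefix (win (pad0 w) N) (w ++ replicate N 0)
padded-prefix w       zero    = w ++ [] , refl
padded-prefix []      (suc N) with padded-prefix [] N
... | rest , e = rest , cong (0 ∷_) e
padded-prefix (x ∷ w) (suc N) with padded-prefix w N
... | rest , e = rest ++ 0 ∷ [] , cong (x ∷_) (begin
    w ++ replicate (suc N) 0            ≡⟨ cong (w ++_) (replicate-snoc N 0) ⟩
    w ++ replicate N 0 ++ 0 ∷ []        ≡⟨ sym (++-assoc w _ _) ⟩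
    (w ++ replicate N 0) ++ 0 ∷ []      ≡⟨ cong (_++ 0 ∷ []) e ⟩
    (win (pad0 w) N ++ rest) ++ 0 ∷ []  ≡⟨ ++-assoc (win (pad0 w) N) rest _ ⟩
    win (pad0 w) N ++ rest ++ 0 ∷ []    ∎)
  where open ≡-Reasoning

factor-of-padded : ∀ {f w} → InfFactorOf f (pad0 w) → ∃ λ M → FactorOf f (w ++ replicate M 0)
factor-of-padded {f} {w} (n , e) with padded-prefix w (n + length f)
... | rest , eq = n + length f , win (pad0 w) n , rest , (begin
    w ++ replicate (n + length f) 0                                ≡⟨ eq ⟩
    win (pad0 w) (n + length f) ++ rest                            ≡⟨ cong (_++ rest) (win-++ (pad0 w) n (length f)) ⟩
    (win (pad0 w) n ++ win (λ i → pad0 w (n + i)) (length f)) ++ rest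
      ≡⟨ cong (λ z → (win (pad0 w) n ++ z) ++ rest) (trans (sym (window≡win (pad0 w) n (length f))) e) ⟩
    (win (pad0 w) n ++ f) ++ rest                                  ≡⟨ ++-assoc (win (pad0 w) n) f rest ⟩
    win (pad0 w) n ++ f ++ rest                                    ∎)
  where open ≡-Reasoning

-- The shape of f: a word ending in 0 outside V is g d 0^ℓ with d ≠ 0, ℓ ≥ 1.

record ZeroTail (f : List ℕ) : Set where
  field
    n         : ℕ
    d         : ℕ
    G         : List ℕ
    d≢0       : d ≢ 0
    reverse-f : reverse f ≡ replicate (suc n) 0 ++ d ∷ G

leadingZeros-block : ∀ t {d} G → d ≢ 0 → leadingZeros (replicate t 0 ++ d ∷ G) ≡ t
leadingZeros-block zero    {zero}  G d≢0 = ⊥-elim (d≢0 refl)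
leadingZeros-block zero    {suc d} G _   = refl
leadingZeros-block (suc t) G d≢0 = cong suc (leadingZeros-block t G d≢0)

trailingZeros-f : ∀ {f} (zt : ZeroTail f) → trailingZeros f ≡ suc (ZeroTail.n zt)
trailingZeros-f zt = trans (cong leadingZeros reverse-f) (leadingZeros-block (suc n) G d≢0)
  where open ZeroTail zt

zeros-or-block : ∀ X → (∃ λ t → X ≡ replicate t 0) ⊎ (∃ λ t → ∃ λ d → ∃ λ G → d ≢ 0 × X ≡ replicate t 0 ++ d ∷ G)
zeros-or-block []          = inj₁ (0 , refl)
zeros-or-block (zero ∷ X) with zeros-or-block X
... | inj₁ (t , e)                 = inj₁ (suc t , cong (0 ∷_) e)
... | inj₂ (t , d , G , d≢0 , e) = inj₂ (suc t , d , G , d≢0 , cong (0 ∷_) e)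
zeros-or-block (suc x ∷ X) = inj₂ (0 , suc x , X , (λ ()) , refl)

-- Nonempty blocks of zeros lie in V (period 1 0^t).
zeros-InV : ∀ t → InV (replicate (suc t) 0)
zeros-InV t = t , replicate t 0 , (1 , 1 ∷ [] , sym (++-identityʳ (1 ∷ replicate t 0))) , replicate-snoc t 0

-- f ends in 0 and f ∉ V, so f is not all zeros
zero-tail : ∀ {f} → ¬ InV f → (∃ λ g → f ≡ g ++ 0 ∷ []) → ZeroTail f
zero-tail nv (g , refl) with zeros-or-block (reverse g)
... | inj₁ (t , e) = ⊥-elim (nv (subst InV (sym f≡zeros) (zeros-InV t)))
  where
    f≡zeros : g ++ 0 ∷ [] ≡ replicate (suc t) 0
    f≡zeros = trans (sym (reverse-involutive _))
                (trans (cong reverse (trans (reverse-++ g (0 ∷ [])) (cong (0 ∷_) e))) (reverse-replicate (suc t) 0))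
... | inj₂ (t , d , G , d≢0 , e) =
  record { n = t ; d = d ; G = G ; d≢0 = d≢0 ; reverse-f = trans (reverse-++ g (0 ∷ [])) (cong (0 ∷_) e) }

-- If G and 0^n 1 G are prefixes of one word then G is periodic with period 0^n 1,
-- so f = reverse (0^(n+1) 1 G) = g 1 0^(n+1) with g a suffix of (1 0^n)^{-∞}: f ∈ V.
periodic-InV : ∀ {f} n G S → reverse f ≡ replicate (suc n) 0 ++ 1 ∷ G →
               Prefix G S → Prefix (replicate n 0 ++ 1 ∷ G) S → InV f
periodic-InV {f} n G S rf preG preT = from-power (prefix-of-power Q G (0<|Q| n) G-prefix-QG)
  where
    open ≡-Reasoning
    Q T : List ℕ
    Q = replicate n 0 ++ 1 ∷ []
    T = replicate n 0 ++ 1 ∷ G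

    0<|Q| : ∀ i → 0 < length (replicate i 0 ++ 1 ∷ [])
    0<|Q| zero    = s≤s z≤n
    0<|Q| (suc i) = s≤s z≤n

    G-prefix-QG : Prefix G (Q ++ G)
    G-prefix-QG = subst (Prefix G) (sym (++-assoc (replicate n 0) (1 ∷ []) G))
      (prefix-of-prefixes G T S preG preT (≤-trans (n≤1+n (length G)) (length-++-≤ʳ (1 ∷ G) {replicate n 0})))

    f≡ : f ≡ reverse T ++ 0 ∷ []
    f≡ = begin
      f                     ≡⟨ sym (reverse-involutive f) ⟩
      reverse (reverse f)   ≡⟨ cong reverse rf ⟩
      reverse (0 ∷ T)       ≡⟨ unfold-reverse 0 T ⟩
      reverse T ++ 0 ∷ []   ∎

    -- from Qᵏ = G C we get Qᵏ⁺¹ = T C, so reverse T is a suffix of (1 0^n)^(k+1)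
    from-power : (∃ λ k → Prefix G (concat (replicate k Q))) → InV f
    from-power (k , C , Qᵏ≡GC) = n , reverse T , (suc k , reverse C , power-suffix) , f≡
      where
        Qᵏ⁺¹≡TC : concat (replicate (suc k) Q) ≡ T ++ C
        Qᵏ⁺¹≡TC = trans (cong (Q ++_) Qᵏ≡GC)
                    (trans (sym (++-assoc Q G C)) (cong (_++ C) (++-assoc (replicate n 0) (1 ∷ []) G)))

        power-suffix : reverse C ++ reverse T ≡ concat (replicate (suc k) (1 ∷ replicate n 0))
        power-suffix = begin
          reverse C ++ reverse T                         ≡⟨ sym (reverse-++ T C) ⟩
          reverse (T ++ C)                               ≡⟨ cong reverse (sym Qᵏ⁺¹≡TC) ⟩
          reverse (concat (replicate (suc k) Q))         ≡⟨ reverse-power (suc k) Q ⟩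
          concat (replicate (suc k) (reverse Q))         ≡⟨ cong (λ z → concat (replicate (suc k) z)) (reverse-bump n) ⟩
          concat (replicate (suc k) (1 ∷ replicate n 0)) ∎

data Tail (f P : List ℕ) : List ℕ → Set where
  stop : Tail f P []
  bump : ∀ m → Suffix f (P ++ replicate (suc m) 0) → Tail f P (replicate m 0 ++ 1 ∷ [])

least? : (Q : ℕ → Set) → (∀ j → Dec (Q j)) → ∀ L →
         (∃ λ m → Q m × (∀ j → j < m → ¬ Q j)) ⊎ (∀ j → j < L → ¬ Q j)
least? Q Q? zero    = inj₂ (λ _ ())
least? Q Q? (suc L) with least? Q Q? L
... | inj₁ found = inj₁ found
... | inj₂ none with Q? L
...   | yes QL = inj₁ (L , QL , none)
...   | no ¬QL = inj₂ (λ j j<1+L → [ none j , (λ { refl → ¬QL }) ]′ (m<1+n⇒m<n∨m≡n j<1+L))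

module Avoidance {f : List ℕ} (nv : ¬ InV f) (zt : ZeroTail f) where
  open ZeroTail zt

  R : List ℕ
  R = replicate (suc n) 0 ++ d ∷ G

  factor⇒R : ∀ {w} → FactorOf f w → FactorOf R (reverse w)
  factor⇒R o = subst (λ u → FactorOf u _) reverse-f (factor-reverse o)

  R⇒factor : ∀ {w} → FactorOf R (reverse w) → FactorOf f w
  R⇒factor o = factor-reverse⁻ (subst (λ u → FactorOf u _) (sym reverse-f) o)

  suffix⇒R : ∀ {P t} → Suffix f (P ++ replicate t 0) → Prefix R (replicate t 0 ++ reverse P)
  suffix⇒R {P} {t} s = subst₂ Prefix reverse-f (reverse-padding P t) (suffix-reverse s)

  R⇒suffix : ∀ {P t} → Prefix R (replicate t 0 ++ reverse P) → Suffix f (P ++ replicate t 0)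
  R⇒suffix {P} {t} pre = prefix-reverse⁻ (subst₂ Prefix (sym reverse-f) (sym (reverse-padding P t)) pre)

  R-head : ∀ {x Y} → Prefix R (x ∷ Y) → x ≡ 0
  R-head (_ , e) = ∷-injectiveˡ e

  avoid-padded : ∀ w → (∀ M → ¬ FactorOf R (replicate M 0 ++ reverse w)) → ¬ InfFactorOf f (pad0 w)
  avoid-padded w none o with factor-of-padded {f} {w} o
  ... | M , oM = none M (subst (FactorOf R) (reverse-padding w M) (factor⇒R oM))

  hit-bound : ∀ {P m} → Suffix f (P ++ replicate (suc m) 0) → m < suc n
  hit-bound {P} {m} s = proj₁ (zeros-prefix (suc n) d G (suc m) (reverse P) (suffix⇒R {P} s) d≢0)

  hit-exact : ∀ {P x m} → x ≢ 0 → Suffix f ((P ++ x ∷ []) ++ replicate (suc m) 0) → m ≡ n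
  hit-exact {P} {x} {m} x≢0 s = suc-injective (proj₁ (block-prefix (suc n) d G (suc m) x (reverse P) pre d≢0 x≢0))
    where
      pre : Prefix R (replicate (suc m) 0 ++ x ∷ reverse P)
      pre = subst (λ Y → Prefix R (replicate (suc m) 0 ++ Y)) (reverse-++ P (x ∷ [])) (suffix⇒R {P ++ x ∷ []} s)

  -- appending a nonzero symbol creates no occurrence of f, as f ends with 0
  avoid-∷ʳ : ∀ {P x} → x ≢ 0 → ¬ FactorOf f P → ¬ FactorOf f (P ++ x ∷ [])
  avoid-∷ʳ {P} {x} x≢0 avoidP o with factor-∷ R x (reverse P) (subst (FactorOf R) (reverse-++ P (x ∷ [])) (factor⇒R o))
  ... | inj₁ pre = x≢0 (R-head pre)
  ... | inj₂ o'  = avoidP (R⇒factor o')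

  module _ (P : List ℕ) (avoidP : ¬ FactorOf f P) where

    Hit : ℕ → Set
    Hit m = Suffix f (P ++ replicate (suc m) 0)

    no-hit-below : ∀ m → (∀ j → j < m → ¬ Hit j) → ¬ FactorOf R (replicate m 0 ++ reverse P)
    no-hit-below m below o with factor-zeros R m (reverse P) o
    ... | inj₂ o'                 = avoidP (R⇒factor o')
    ... | inj₁ (zero , _ , pre)   = avoidP (R⇒factor (prefix⇒factor pre))
    ... | inj₁ (suc j , j<m , pre) = below j j<m (R⇒suffix {P} pre)

    avoid-bump : ∀ m → Hit m → (∀ j → j < m → ¬ Hit j) → ¬ InfFactorOf f (pad0 (P ++ replicate m 0 ++ 1 ∷ []))
    avoid-bump m hit below = avoid-padded (P ++ replicate m 0 ++ 1 ∷ []) no-occurrence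
      where
        S : List ℕ
        S = replicate m 0 ++ reverse P

        reverse-w : reverse (P ++ replicate m 0 ++ 1 ∷ []) ≡ 1 ∷ S
        reverse-w = trans (reverse-++ P _) (cong (_++ reverse P) (reverse-bump m))

        no-occurrence : ∀ M → ¬ FactorOf R (replicate M 0 ++ reverse (P ++ replicate m 0 ++ 1 ∷ []))
        no-occurrence M o with factor-zeros R M (1 ∷ S) (subst (λ Y → FactorOf R (replicate M 0 ++ Y)) reverse-w o)
        ... | inj₁ (t , _ , pre) with block-prefix (suc n) d G t 1 S pre d≢0 (λ ())
        ...   | _ , refl , preG = nv (periodic-InV n G S reverse-f preG (prefix-∷⁻ (suffix⇒R {P} hit)))
        no-occurrence M o | inj₂ o' with factor-∷ R 1 S o'
        ... | inj₁ pre = 0≢1+n (sym (R-head pre))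
        ... | inj₂ o'' = no-hit-below m below o''

    least-tail : ∃ λ r → Tail f P r × ¬ InfFactorOf f (pad0 (P ++ r))
    least-tail with least? Hit (λ m → suffix? f (P ++ replicate (suc m) 0)) (suc n)
    ... | inj₁ (m , hit , below) = replicate m 0 ++ 1 ∷ [] , bump m hit , avoid-bump m hit below
    ... | inj₂ none = [] , stop , subst (λ w → ¬ InfFactorOf f (pad0 w)) (sym (++-identityʳ P))
                                    (avoid-padded P (λ M → no-hit-below M (λ j _ hit → none j (hit-bound hit) hit)))

  tail-shape1 : ∀ {P r} → Tail f P r → Shape1 (trailingZeros f) r
  tail-shape1 stop         = inj₁ refl
  tail-shape1 (bump m hit) = inj₂ (m , subst (m <_) (sym (trailingZeros-f zt)) (hit-bound hit) , refl)

  tail-shape2 : ∀ {k P r} → Tail f (P ++ suc k ∷ []) r → Shape2 (2 + k) (trailingZeros f) (suc k ∷ r)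
  tail-shape2 stop = inj₁ refl
  tail-shape2 {k} (bump m hit) =
    inj₂ (cong (λ t → suc k ∷ replicate t 0 ++ 1 ∷ []) (trans (hit-exact (λ ()) hit) (cong (_∸ 1) (sym (trailingZeros-f zt)))))

parity : ∀ n → n % 2 ≡ 0 ⊎ n % 2 ≡ 1
parity zero          = inj₁ refl
parity (suc zero)    = inj₂ refl
parity (suc (suc n)) = parity n

+-parity : ∀ x y z w → x % 2 ≡ y % 2 → z % 2 ≡ w % 2 → (x + z) % 2 ≡ (y + w) % 2
+-parity x y z w ex ez =
  trans (%-distribˡ-+ x z 2) (trans (cong₂ (λ a b → (a + b) % 2) ex ez) (sym (%-distribˡ-+ y w 2)))

shift : ∀ w {b} σ → w % 2 ≡ b → (w + σ) % 2 ≡ (b + σ) % 2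
shift w {b} σ e = +-parity w b σ σ (trans e (sym (m<n⇒m%n≡m b<2))) refl
  where
    b<2 : b < 2
    b<2 = subst (_< 2) e (m%n<n w 2)

weight-++ : ∀ x y → weight (x ++ y) ≡ weight x + weight y
weight-++ []      y = refl
weight-++ (a ∷ x) y = trans (cong (symWeight a +_) (weight-++ x y)) (sym (+-assoc (symWeight a) _ _))

-- words over {0,1}; they have even weight, since weight 1 has weight 2
Binary : List ℕ → Set
Binary = All (_≤ 1)

binary-even : ∀ w → Binary w → weight w % 2 ≡ 0
binary-even []                 _                 = refl
binary-even (zero ∷ w)         (_ All.∷ b)       = binary-even w b
binary-even (suc zero ∷ w)     (_ All.∷ b)       = +-parity 2 0 (weight w) 0 refl (binary-even w b)
binary-even (suc (suc x) ∷ w)  (s≤s () All.∷ _)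

binary-word : ∀ {k r} → Binary r → Word (2 + k) r
binary-word = All.map (λ x≤1 → s≤s (≤-trans x≤1 (s≤s z≤n)))

tail-binary : ∀ {f P r} → Tail f P r → Binary r
tail-binary stop       = All.[]
tail-binary (bump m _) = bump-binary m
  where
    bump-binary : ∀ m → Binary (replicate m 0 ++ 1 ∷ [])
    bump-binary zero    = ≤-refl All.∷ All.[]
    bump-binary (suc m) = z≤n All.∷ bump-binary m

prefix-parity : ∀ P r → Binary r → ∀ j → weight (win (pad0 (P ++ r)) (length P + j)) % 2 ≡ weight P % 2
prefix-parity P r br j = begin
  weight (win (pad0 (P ++ r)) (length P + j)) % 2   ≡⟨ cong (λ w → weight w % 2) (win-pad0-++ P r j) ⟩
  weight (P ++ win (pad0 r) j) % 2                  ≡⟨ cong (_% 2) (weight-++ P _) ⟩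
  (weight P + weight (win (pad0 r) j)) % 2          ≡⟨ +-parity (weight P) (weight P) (weight (win (pad0 r) j)) 0 refl (binary-even _ (binary-window r br j)) ⟩
  (weight P + 0) % 2                                ≡⟨ cong (_% 2) (+-identityʳ (weight P)) ⟩
  weight P % 2                                      ∎
  where
    open ≡-Reasoning
    binary-window : ∀ r → Binary r → ∀ j → Binary (win (pad0 r) j)
    binary-window r       br        zero    = All.[]
    binary-window []      br        (suc j) = z≤n All.∷ binary-window [] br j
    binary-window (x ∷ r) (x≤1 All.∷ br) (suc j) = x≤1 All.∷ binary-window r br j

-- appending the maximal symbol q-1, of odd weight q, flips the parity
append-max-parity : ∀ {k p σ} → (2 + k) % 2 ≡ 1 → (weight p + σ) % 2 ≡ 1 → (weight (p ++ suc k ∷ []) + σ) % 2 ≡ 0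
append-max-parity {k} {p} {σ} q-odd odd = begin
  (weight (p ++ suc k ∷ []) + σ) % 2   ≡⟨ cong (λ w → (w + σ) % 2) (weight-++ p (suc k ∷ [])) ⟩
  (weight p + (2 + k + 0) + σ) % 2     ≡⟨ cong (_% 2) (right-comm (weight p) (2 + k + 0) σ) ⟩
  (weight p + σ + (2 + k + 0)) % 2     ≡⟨ +-parity (weight p + σ) 1 (2 + k + 0) 1 odd (trans (cong (_% 2) (+-identityʳ (2 + k))) q-odd) ⟩
  (1 + 1) % 2                          ∎
  where
    open ≡-Reasoning
    right-comm : ∀ x y z → x + y + z ≡ x + z + y
    right-comm x y z = trans (+-assoc x y z) (trans (cong (x +_) (+-comm y z)) (sym (+-assoc x z y)))

data Beats (σ : ℕ) (s t : ℕ → ℕ) (k : ℕ) : Set where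
  below : (weight (window s 0 k) + σ) % 2 ≡ 0 → s k < t k → Beats σ s t k
  above : (weight (window s 0 k) + σ) % 2 ≡ 1 → s k > t k → Beats σ s t k

_◁[_]_ : (ℕ → ℕ) → ℕ → (ℕ → ℕ) → Set
s ◁[ σ ] t = ∃ λ k → (∀ i → i < k → s i ≡ t i) × Beats σ s t k

◁⇒◁[0] : ∀ {s t} → s ◁ t → s ◁[ 0 ] t
◁⇒◁[0] {s} (k , agree , inj₁ (even , lt)) = k , agree , below (shift (weight (window s 0 k)) 0 even) lt
◁⇒◁[0] {s} (k , agree , inj₂ (odd , gt))  = k , agree , above (shift (weight (window s 0 k)) 0 odd) gt

◁⇒◁[1]⁻ : ∀ {s t} → t ◁ s → s ◁[ 1 ] t
◁⇒◁[1]⁻ {s} {t} (k , agree , beats) = k , agree' , flip beats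
  where
    agree' : ∀ i → i < k → s i ≡ t i
    agree' i i<k = sym (agree i i<k)
    same : weight (window s 0 k) % 2 ≡ weight (window t 0 k) % 2
    same = cong (λ w → weight w % 2) (window-agree k agree')
    flip : (EvenParity (window t 0 k) × t k < s k) ⊎ (OddParity (window t 0 k) × t k > s k) → Beats 1 s t k
    flip (inj₁ (even , lt)) = above (shift (weight (window s 0 k)) 1 (trans same even)) lt
    flip (inj₂ (odd , gt))  = below (shift (weight (window s 0 k)) 1 (trans same odd)) gt

Least : ℕ → List ℕ → List ℕ → ℕ → (ℕ → ℕ) → Set
Least q f p σ c = InSet q f p c × (∀ b → InSet q f p b → ¬ b ◁[ σ ] c)

first-is-least : ∀ {q f p a c} → IsFirst q f p a → Least q f p 0 c → a ≈ c
first-is-least (a∈ , first) (c∈ , least) with first _ c∈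
... | inj₁ a≈c = a≈c
... | inj₂ a◁c = ⊥-elim (least _ a∈ (◁⇒◁[0] a◁c))

last-is-least : ∀ {q f p a c} → IsLast q f p a → Least q f p 1 c → a ≈ c
last-is-least (a∈ , last) (c∈ , least) with last _ c∈
... | inj₁ c≈a = λ i → sym (c≈a i)
... | inj₂ c◁a = ⊥-elim (least _ a∈ (◁⇒◁[1]⁻ c◁a))

beats-equal : ∀ {σ s t k} → s k ≡ t k → ¬ Beats σ s t k
beats-equal e (below _ lt) = <-irrefl e lt
beats-equal e (above _ gt) = <-irrefl (sym e) gt

below-bump : ∀ m j {x} → x < pad0 (replicate m 0 ++ 1 ∷ []) j → j ≡ m × x ≡ 0
below-bump zero    zero    x<1 = refl , n<1⇒n≡0 x<1
below-bump zero    (suc j) ()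
below-bump (suc m) zero    ()
below-bump (suc m) (suc j) lt  = map₁ (cong suc) (below-bump m j lt)

below-candidate : ∀ {f P r b} → Tail f P r → ¬ InfFactorOf f b → ∀ j →
  (∀ i → i < length P + j → b i ≡ pad0 (P ++ r) i) → ¬ b (length P + j) < pad0 (P ++ r) (length P + j)
below-candidate {P = P} {b = b} stop _ j _ lt = n≮0 (subst (b (length P + j) <_) (pad0-++ P [] j) lt)
below-candidate {f} {P} {b = b} (bump m (A , hit)) avoid j agree lt
  with below-bump m j (subst (b (length P + j) <_) (pad0-++ P _ j) lt)
... | refl , b≡0 = avoid (window-suffix⇒factor b (k + 1) A (begin
  win b (k + 1)                     ≡⟨ win-++ b k 1 ⟩
  win b k ++ b (k + 0) ∷ []         ≡⟨ cong₂ (λ u x → u ++ x ∷ []) (win-cong b c k agree) (trans (cong b (+-identityʳ k)) b≡0) ⟩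
  win c k ++ 0 ∷ []                 ≡⟨ cong (_++ 0 ∷ []) (win-pad0-++ P (replicate j 0 ++ 1 ∷ []) j) ⟩
  (P ++ win (pad0 (replicate j 0 ++ 1 ∷ [])) j) ++ 0 ∷ []
                                    ≡⟨ cong (λ z → (P ++ z) ++ 0 ∷ []) (win-pad0-zeros j (1 ∷ [])) ⟩
  (P ++ replicate j 0) ++ 0 ∷ []    ≡⟨ ++-assoc P _ _ ⟩
  P ++ replicate j 0 ++ 0 ∷ []      ≡⟨ cong (P ++_) (sym (replicate-snoc j 0)) ⟩
  P ++ replicate (suc j) 0          ≡⟨ hit ⟩
  A ++ f                            ∎))
  where
    open ≡-Reasoning
    k : ℕ
    k = length P + j
    c : ℕ → ℕ
    c = pad0 (P ++ replicate j 0 ++ 1 ∷ [])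

beats-beyond : ∀ {f P r b σ} → Tail f P r → (weight P + σ) % 2 ≡ 0 → ¬ InfFactorOf f b →
  ∀ k → length P ≤ k → (∀ i → i < k → b i ≡ pad0 (P ++ r) i) → ¬ Beats σ b (pad0 (P ++ r)) k
beats-beyond {f} {P} {r} {b} {σ} tail even avoid k P≤k = subst Unbeaten (m+[n∸m]≡n P≤k) (at-offset (k ∸ length P))
  where
    c : ℕ → ℕ
    c = pad0 (P ++ r)
    Unbeaten : ℕ → Set
    Unbeaten k = (∀ i → i < k → b i ≡ c i) → ¬ Beats σ b c k

    at-offset : ∀ j → Unbeaten (length P + j)
    at-offset j agree (below _ lt) = below-candidate tail avoid j agree lt
    at-offset j agree (above odd _) = 0≢1+n (trans (sym even-b) odd)
      where
        even-b : (weight (window b 0 (length P + j)) + σ) % 2 ≡ 0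
        even-b = trans (+-parity (weight (window b 0 (length P + j))) (weight P) σ σ (trans (cong (λ w → weight w % 2)
                         (trans (window-agree _ agree) (window≡win c 0 _))) (prefix-parity P r (tail-binary tail) j)) refl) even

beats-max : ∀ {k p r b σ} → InfWord (2 + k) b → PrefixOf p b → (weight p + σ) % 2 ≡ 1 →
  ¬ Beats σ b (pad0 (p ++ suc k ∷ r)) (length p)
beats-max {σ = σ} _ pb odd (below even _) = 0≢1+n (trans (sym even) (trans (cong (λ w → (weight w + σ) % 2) pb) odd))
beats-max {k} {p} {r} {b} b<q _ _ (above _ gt) =
  <⇒≱ (subst (_< b (length p)) (pad0-after p (suc k) r) gt) (≤-pred (b<q (length p)))

candidate-in-set : ∀ {q f p r} → Word (suc q) p → Word (suc q) r → ¬ InfFactorOf f (pad0 (p ++ r)) →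
  InSet (suc q) f p (pad0 (p ++ r))
candidate-in-set {p = p} {r} wp wr avoid = pad0-word (p ++ r) (++⁺ wp wr) , avoid , candidate-prefix p r

even-least : ∀ {k f P r σ} → Word (2 + k) P → Tail f P r → ¬ InfFactorOf f (pad0 (P ++ r)) →
  (weight P + σ) % 2 ≡ 0 → Least (2 + k) f P σ (pad0 (P ++ r))
even-least {P = P} {r} wP tail avoid even = candidate-in-set wP (binary-word (tail-binary tail)) avoid , unbeaten
  where
    unbeaten : ∀ b → InSet _ _ P b → ¬ b ◁[ _ ] pad0 (P ++ r)
    unbeaten b (_ , avoid-b , pb) (k , agree , beats) with k <? length P
    ... | yes k<P = beats-equal (prefix-agree pb (candidate-prefix P r) k<P) beats
    ... | no  k≮P = beats-beyond tail even avoid-b k (≮⇒≥ k≮P) agree beats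

odd-least : ∀ {k f p r σ} → Word (2 + k) p → Tail f (p ++ suc k ∷ []) r →
  ¬ InfFactorOf f (pad0 ((p ++ suc k ∷ []) ++ r)) → (weight p + σ) % 2 ≡ 1 →
  (weight (p ++ suc k ∷ []) + σ) % 2 ≡ 0 → Least (2 + k) f p σ (pad0 (p ++ suc k ∷ r))
odd-least {k} {f} {p} {r} {σ} wp tail avoid odd even =
  candidate-in-set wp (≤-refl All.∷ binary-word (tail-binary tail)) (subst (λ w → ¬ InfFactorOf f (pad0 w)) assoc avoid) ,
  unbeaten
  where
    assoc : (p ++ suc k ∷ []) ++ r ≡ p ++ suc k ∷ r
    assoc = ++-assoc p (suc k ∷ []) r

    |p|<k⇒|P|≤k : ∀ {k'} → length p < k' → length (p ++ suc k ∷ []) ≤ k'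
    |p|<k⇒|P|≤k = subst (_≤ _) (sym (trans (length-++ p) (+-comm (length p) 1)))

    unbeaten : ∀ b → InSet _ _ p b → ¬ b ◁[ σ ] pad0 (p ++ suc k ∷ r)
    unbeaten b (b<q , avoid-b , pb) (k' , agree , beats) with <-cmp k' (length p)
    ... | tri< k'<p _ _ = beats-equal (prefix-agree pb (candidate-prefix p (suc k ∷ r)) k'<p) beats
    ... | tri≈ _ refl _ = beats-max b<q pb odd beats
    ... | tri> _ _ p<k' = subst (λ w → (∀ i → i < k' → b i ≡ pad0 w i) → ¬ Beats σ b (pad0 w) k') assoc
                            (beats-beyond tail even avoid-b k' (|p|<k⇒|P|≤k p<k')) agree beats

least-word : ∀ k → (2 + k) % 2 ≡ 1 → ∀ f → ¬ InV f → ZeroTail f → ∀ p → Word (2 + k) p → ¬ FactorOf f p → ∀ σ →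
  ∃ λ r → Least (2 + k) f p σ (pad0 (p ++ r)) ×
          ((weight p + σ) % 2 ≡ 0 → Shape1 (trailingZeros f) r) ×
          ((weight p + σ) % 2 ≡ 1 → Shape2 (2 + k) (trailingZeros f) r)
least-word k q-odd f nv zt p wp avoid-p σ = by-parity (parity (weight p + σ))
  where
    open Avoidance nv zt

    by-parity : (weight p + σ) % 2 ≡ 0 ⊎ (weight p + σ) % 2 ≡ 1 →
      ∃ λ r → Least (2 + k) f p σ (pad0 (p ++ r)) ×
              ((weight p + σ) % 2 ≡ 0 → Shape1 (trailingZeros f) r) ×
              ((weight p + σ) % 2 ≡ 1 → Shape2 (2 + k) (trailingZeros f) r)
    by-parity (inj₁ even) with least-tail p avoid-p
    ... | r , tail , avoid =
      r , even-least wp tail avoid even , (λ _ → tail-shape1 tail) , (λ odd → ⊥-elim (0≢1+n (trans (sym even) odd)))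
    by-parity (inj₂ odd) with least-tail (p ++ suc k ∷ []) (avoid-∷ʳ (λ ()) avoid-p)
    ... | r , tail , avoid =
      suc k ∷ r , odd-least wp tail avoid odd (append-max-parity {k} {p} {σ} q-odd odd) ,
      (λ even → ⊥-elim (0≢1+n (trans (sym even) odd))) , (λ _ → tail-shape2 tail)

proposition8 : (q : ℕ) → 3 ≤ q → q % 2 ≡ 1 →
    (f : List ℕ) → Word q f → ¬ InV f → (∃ λ g → f ≡ g ++ (0 ∷ [])) →
    (p : List ℕ) → Word q p → ¬ FactorOf f p →
    (a : ℕ → ℕ) →
    (IsFirst q f p a → ∃ λ r → a ≈ pad0 (p ++ r) ×
        (EvenParity p → Shape1 (trailingZeros f) r) ×
        (OddParity p → Shape2 q (trailingZeros f) r)) ×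
    (IsLast q f p a → ∃ λ r → a ≈ pad0 (p ++ r) ×
        (OddParity p → Shape1 (trailingZeros f) r) ×
        (EvenParity p → Shape2 q (trailingZeros f) r))
proposition8 (suc (suc k)) _ q-odd f _ nv ends-0 p wp avoid-p a =
  (λ isFirst → let r , least , shape1 , shape2 = least-word k q-odd f nv zt p wp avoid-p 0 in
     r , first-is-least isFirst least , (λ even → shape1 (shift (weight p) 0 even)) , (λ odd → shape2 (shift (weight p) 0 odd))) ,
  (λ isLast → let r , least , shape1 , shape2 = least-word k q-odd f nv zt p wp avoid-p 1 in
     r , last-is-least isLast least , (λ odd → shape1 (shift (weight p) 1 odd)) , (λ even → shape2 (shift (weight p) 1 even)))
  where
    zt : ZeroTail f
    zt = zero-tail nv ends-0
proposition8 (suc zero) (s≤s ()) _ _ _ _ _ _ _ _ _
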